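{- Assume the setting below. Then each $\jmath_X$ is a closure operator on $Q(X)$. Setting $Q^{\jmath}(X):=\{\alpha\in Q(X)\mid\jmath_X(\alpha)=\alpha\}$ (a complete lattice, with supremum of a family given by $\jmath_X$ of its supremum in $Q(X)$) and $Q^{\jmath}(f):=\jmath_Y\circ Q(f)$ restricted to $Q^\jmath(X)$ for $f:X\to Y$, $Q^{\jmath}:\mathsf{C}\to\mathsf{SLatt}$ is a functor, and $\jmath_X:Q(X)\to Q^{\jmath}(X)$ is a surjective sup-preserving map, natural in $X$. Moreover, if $f:X\to Y$ is invertible, then $Q(f)$ restricts to a map $Q^{\jmath}(X)\to Q^{\jmath}(Y)$.
   Context: $(\mathsf{C},\otimes,I,a,\lambda,\rho,\sigma)$ is a $*$-autonomous category: symmetric monoidal closed, internal hom $\multimap$, counit $\mathrm{ev}_{X,Y}:X\otimes(X\multimap Y)\to Y$, with a dualizing object $0$ (the canonical arrows $j_X:X\to X^{**}$, $X^*:=X\multimap0$, are invertible). $Q:\mathsf{C}\to\mathsf{SLatt}$ is a monoidal functor into complete lattices and sup-preserving maps: there are $u\in Q(I)$ and maps $\mu_{X,Y}:Q(X)\times Q(Y)\to Q(X\otimes Y)$, sup-preserving in each variable, natural ($Q(f\otimes g)\circ\mu_{X,Y}=\mu_{X',Y'}\circ(Q(f)\times Q(g))$), and satisfying $Q(\lambda_Y)(\mu_{I,Y}(u,y))=y$, $Q(\rho_X)(\mu_{X,I}(x,u))=x$, $Q(a)(\mu(\mu(x,y),z))=\mu(x,\mu(y,z))$, $Q(\sigma_{X,Y})(\mu_{X,Y}(x,y))=\mu_{Y,X}(y,x)$.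 Put $\langle x,b\rangle_{X,Y}:=Q(\mathrm{ev}_{X,Y})(\mu_{X,X\multimap Y}(x,b))$, which is sup-preserving in each variable; $\iota_{X,Y}(\alpha,-)$ denotes the right adjoint of $\langle\alpha,-\rangle_{X,Y}$. Fix $\omega\in Q(0)$ and write $\langle\alpha,\beta\rangle_X:=\langle\alpha,\beta\rangle_{X,0}$, $\omega_X(\alpha):=\iota_{X,0}(\alpha,\omega)\in Q(X^*)$, and for $\beta\in Q(X^*)$, $\beta^{\perp}:=\bigvee\{\alpha\in Q(X)\mid\langle\alpha,\beta\rangle_X\le\omega\}$ (so $\alpha\le\beta^\perp\iff\langle\alpha,\beta\rangle_X\le\omega\iff\beta\le\omega_X(\alpha)$). Define $\jmath_X(\alpha):=(\omega_X(\alpha))^{\perp}$. -}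

module Defs where

open import Level using (Level; _⊔_) renaming (suc to lsuc)
open import Relation.Binary.PropositionalEquality using (_≡_)
open import Relation.Binary.Core using (Rel)
open import Relation.Binary.Structures using (IsPartialOrder)
open import Data.Product using (Σ; _,_; proj₁)

record Category (o m : Level) : Set (lsuc (o ⊔ m)) where
  infixr 9 _∘_
  field
    Obj : Set o
    Hom : Obj → Obj → Set m
    id  : ∀ {X} → Hom X X
    _∘_ : ∀ {X Y Z} → Hom Y Z → Hom X Y → Hom X Z
    identityˡ : ∀ {X Y} {f : Hom X Y} → id ∘ f ≡ f
    identityʳ : ∀ {X Y} {f : Hom X Y} → f ∘ id ≡ f
    assoc : ∀ {W X Y Z} {f : Hom W X} {g : Hom X Y} {h : Hom Y Z} →
            (h ∘ g) ∘ f ≡ h ∘ (g ∘ f)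

  record IsIso {X Y : Obj} (f : Hom X Y) : Set m where
    field
      inv : Hom Y X
      isoˡ : inv ∘ f ≡ id
      isoʳ : f ∘ inv ≡ id

record SymmetricMonoidalClosed (o m : Level) : Set (lsuc (o ⊔ m)) where
  field
    cat : Category o m
  open Category cat
  infixr 10 _⊗₀_ _⊗₁_
  infixr 5 _⊸_
  field
    _⊗₀_ : Obj → Obj → Obj
    _⊗₁_ : ∀ {X X' Y Y'} → Hom X X' → Hom Y Y' → Hom (X ⊗₀ Y) (X' ⊗₀ Y')
    ⊗-id : ∀ {X Y} → id {X} ⊗₁ id {Y} ≡ id
    ⊗-∘  : ∀ {X X' X'' Y Y' Y''} {f : Hom X X'} {f' : Hom X' X''}
             {g : Hom Y Y'} {g' : Hom Y' Y''} →
           (f' ∘ f) ⊗₁ (g' ∘ g) ≡ (f' ⊗₁ g') ∘ (f ⊗₁ g)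
    I : Obj
    a : ∀ {X Y Z} → Hom ((X ⊗₀ Y) ⊗₀ Z) (X ⊗₀ (Y ⊗₀ Z))
    a-iso : ∀ {X Y Z} → IsIso (a {X} {Y} {Z})
    a-natural : ∀ {X X' Y Y' Z Z'} {f : Hom X X'} {g : Hom Y Y'} {h : Hom Z Z'} →
                a ∘ ((f ⊗₁ g) ⊗₁ h) ≡ (f ⊗₁ (g ⊗₁ h)) ∘ a
    lam : ∀ {X} → Hom (I ⊗₀ X) X
    lam-iso : ∀ {X} → IsIso (lam {X})
    lam-natural : ∀ {X Y} {f : Hom X Y} → f ∘ lam ≡ lam ∘ (id ⊗₁ f)
    rho : ∀ {X} → Hom (X ⊗₀ I) X
    rho-iso : ∀ {X} → IsIso (rho {X})
    rho-natural : ∀ {X Y} {f : Hom X Y} → f ∘ rho ≡ rho ∘ (f ⊗₁ id)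
    sym : ∀ {X Y} → Hom (X ⊗₀ Y) (Y ⊗₀ X)
    sym-natural : ∀ {X X' Y Y'} {f : Hom X X'} {g : Hom Y Y'} →
                  sym ∘ (f ⊗₁ g) ≡ (g ⊗₁ f) ∘ sym
    sym-involutive : ∀ {X Y} → sym {Y} {X} ∘ sym {X} {Y} ≡ id
    triangle : ∀ {X Y} → (id {X} ⊗₁ lam {Y}) ∘ a ≡ rho ⊗₁ id
    pentagon : ∀ {W X Y Z} →
               (id {W} ⊗₁ a {X} {Y} {Z}) ∘ (a ∘ (a ⊗₁ id)) ≡ a ∘ a
    hexagon : ∀ {X Y Z} →
              a {Y} {Z} {X} ∘ (sym ∘ a) ≡ (id ⊗₁ sym) ∘ (a ∘ (sym ⊗₁ id))
    _⊸_ : Obj → Obj → Obj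
    ev : ∀ {X Y} → Hom (X ⊗₀ (X ⊸ Y)) Y
    curry : ∀ {X Y Z} → Hom (X ⊗₀ Z) Y → Hom Z (X ⊸ Y)
    ev-curry : ∀ {X Y Z} {f : Hom (X ⊗₀ Z) Y} → ev ∘ (id ⊗₁ curry f) ≡ f
    curry-unique : ∀ {X Y Z} {f : Hom (X ⊗₀ Z) Y} {g : Hom Z (X ⊸ Y)} →
                   ev ∘ (id ⊗₁ g) ≡ f → g ≡ curry f

  canonical : (𝟘 X : Obj) → Hom X ((X ⊸ 𝟘) ⊸ 𝟘)
  canonical 𝟘 X = curry (ev {X} {𝟘} ∘ sym {X ⊸ 𝟘} {X})

record StarAutonomous (o m : Level) : Set (lsuc (o ⊔ m)) where
  field
    smcc : SymmetricMonoidalClosed o m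
  open SymmetricMonoidalClosed smcc
  open Category cat
  field
    dualizing : Obj
    dualizing-iso : ∀ X → IsIso (canonical dualizing X)

record CompleteLattice (ℓ : Level) : Set (lsuc ℓ) where
  infix 4 _≈_ _≤_
  field
    Carrier : Set ℓ
    _≈_ : Rel Carrier ℓ
    _≤_ : Rel Carrier ℓ
    isPartialOrder : IsPartialOrder _≈_ _≤_
    ⋁ : ∀ {J : Set ℓ} → (J → Carrier) → Carrier
    ⋁-upper : ∀ {J : Set ℓ} (g : J → Carrier) (i : J) → g i ≤ ⋁ g
    ⋁-least : ∀ {J : Set ℓ} (g : J → Carrier) (x : Carrier) →
              (∀ i → g i ≤ x) → ⋁ g ≤ x

open CompleteLattice using (Carrier)

record SupMap {ℓ} (A B : CompleteLattice ℓ) : Set (lsuc ℓ) where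
  private
    module A = CompleteLattice A
    module B = CompleteLattice B
  field
    fun : A.Carrier → B.Carrier
    cong : ∀ {x y} → x A.≈ y → fun x B.≈ fun y
    pres-⋁ : ∀ {J : Set ℓ} (g : J → A.Carrier) → fun (A.⋁ g) B.≈ B.⋁ (λ i → fun (g i))

record SLattFunctor {o m} (C : Category o m) (ℓ : Level) : Set (o ⊔ m ⊔ lsuc ℓ) where
  open Category C
  field
    F₀ : Obj → CompleteLattice ℓ
    F₁ : ∀ {X Y} → Hom X Y → SupMap (F₀ X) (F₀ Y)
  open CompleteLattice
  field
    F-id : ∀ {X} (x : Carrier (F₀ X)) → _≈_ (F₀ X) (SupMap.fun (F₁ (id {X})) x) x
    F-∘  : ∀ {X Y Z} (f : Hom X Y) (g : Hom Y Z) (x : Carrier (F₀ X)) →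
           _≈_ (F₀ Z) (SupMap.fun (F₁ (g ∘ f)) x) (SupMap.fun (F₁ g) (SupMap.fun (F₁ f) x))

record MonoidalSLattFunctor {o m} (V : SymmetricMonoidalClosed o m) (ℓ : Level)
       : Set (o ⊔ m ⊔ lsuc ℓ) where
  open SymmetricMonoidalClosed V
  open Category cat
  field
    functor : SLattFunctor cat ℓ
  open SLattFunctor functor
  open CompleteLattice
  Q₀ : Obj → Set ℓ
  Q₀ X = Carrier (F₀ X)
  Q₁ : ∀ {X Y} → Hom X Y → Q₀ X → Q₀ Y
  Q₁ f = SupMap.fun (F₁ f)
  field
    u  : Q₀ I
    μ  : ∀ {X Y} → Q₀ X → Q₀ Y → Q₀ (X ⊗₀ Y)
    μ-cong : ∀ {X Y} {x x' : Q₀ X} {y y' : Q₀ Y} →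
             _≈_ (F₀ X) x x' → _≈_ (F₀ Y) y y' → _≈_ (F₀ (X ⊗₀ Y)) (μ x y) (μ x' y')
    μ-⋁ˡ : ∀ {X Y} {J : Set ℓ} (g : J → Q₀ X) (y : Q₀ Y) →
           _≈_ (F₀ (X ⊗₀ Y)) (μ (⋁ (F₀ X) g) y) (⋁ (F₀ (X ⊗₀ Y)) (λ i → μ (g i) y))
    μ-⋁ʳ : ∀ {X Y} {J : Set ℓ} (x : Q₀ X) (g : J → Q₀ Y) →
           _≈_ (F₀ (X ⊗₀ Y)) (μ x (⋁ (F₀ Y) g)) (⋁ (F₀ (X ⊗₀ Y)) (λ i → μ x (g i)))
    μ-natural : ∀ {X X' Y Y'} (f : Hom X X') (g : Hom Y Y') (x : Q₀ X) (y : Q₀ Y) →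
                _≈_ (F₀ (X' ⊗₀ Y')) (Q₁ (f ⊗₁ g) (μ x y)) (μ (Q₁ f x) (Q₁ g y))
    unitˡ : ∀ {Y} (y : Q₀ Y) → _≈_ (F₀ Y) (Q₁ lam (μ u y)) y
    unitʳ : ∀ {X} (x : Q₀ X) → _≈_ (F₀ X) (Q₁ rho (μ x u)) x
    μ-assoc : ∀ {X Y Z} (x : Q₀ X) (y : Q₀ Y) (z : Q₀ Z) →
              _≈_ (F₀ (X ⊗₀ (Y ⊗₀ Z))) (Q₁ a (μ (μ x y) z)) (μ x (μ y z))
    μ-sym : ∀ {X Y} (x : Q₀ X) (y : Q₀ Y) →
            _≈_ (F₀ (Y ⊗₀ X)) (Q₁ sym (μ x y)) (μ y x)

record Setting (o m ℓ : Level) : Set (lsuc (o ⊔ m ⊔ ℓ)) where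
  field
    C : StarAutonomous o m
  open StarAutonomous C public
  open SymmetricMonoidalClosed smcc public
  open Category cat public
  field
    Q : MonoidalSLattFunctor smcc ℓ
  open MonoidalSLattFunctor Q public
  open SLattFunctor functor public
  field
    ω : Q₀ dualizing

  Eq : ∀ X → Q₀ X → Q₀ X → Set ℓ
  Eq X = CompleteLattice._≈_ (F₀ X)
  Le : ∀ X → Q₀ X → Q₀ X → Set ℓ
  Le X = CompleteLattice._≤_ (F₀ X)
  Sup : ∀ X {J : Set ℓ} → (J → Q₀ X) → Q₀ X
  Sup X = CompleteLattice.⋁ (F₀ X)

  pair : ∀ {X Y} → Q₀ X → Q₀ (X ⊸ Y) → Q₀ Y
  pair {X} {Y} x b = Q₁ (ev {X} {Y}) (μ x b)

  -- ι_{X,Y}(α , γ): the right adjoint of ⟨α , -⟩_{X,Y}, evaluated at γ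
  iota : ∀ {X Y} → Q₀ X → Q₀ Y → Q₀ (X ⊸ Y)
  iota {X} {Y} α γ =
    Sup (X ⊸ Y) {Σ (Q₀ (X ⊸ Y)) (λ b → Le Y (pair α b) γ)} proj₁

  omegaX : ∀ {X} → Q₀ X → Q₀ (X ⊸ dualizing)
  omegaX α = iota α ω

  perp : ∀ {X} → Q₀ (X ⊸ dualizing) → Q₀ X
  perp {X} β = Sup X {Σ (Q₀ X) (λ α → Le dualizing (pair α β) ω)} proj₁

  jj : ∀ X → Q₀ X → Q₀ X
  jj X α = perp {X} (omegaX α)

  Closed : ∀ X → Q₀ X → Set ℓ
  Closed X α = Eq X (jj X α) α

  Qj₁ : ∀ {X Y} → Hom X Y → Q₀ X → Q₀ Y
  Qj₁ {X} {Y} f α = jj Y (Q₁ f α)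

record Conclusion {o m ℓ} (S : Setting o m ℓ) : Set (lsuc (o ⊔ m ⊔ ℓ)) where
  open Setting S
  open Category cat using () renaming (_∘_ to _∘C_; id to idC)
  field
    jj-extensive : ∀ X (α : Q₀ X) → Le X α (jj X α)
    jj-monotone  : ∀ X (α β : Q₀ X) → Le X α β → Le X (jj X α) (jj X β)
    jj-idempotent : ∀ X (α : Q₀ X) → Eq X (jj X (jj X α)) (jj X α)
    sup-closed : ∀ X {J : Set ℓ} (g : J → Q₀ X) → (∀ i → Closed X (g i)) →
                 Closed X (jj X (Sup X g))
    sup-upper : ∀ X {J : Set ℓ} (g : J → Q₀ X) → (∀ i → Closed X (g i)) →
                ∀ i → Le X (g i) (jj X (Sup X g))
    sup-least : ∀ X {J : Set ℓ} (g : J → Q₀ X) → (∀ i → Closed X (g i)) →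
                ∀ (β : Q₀ X) → Closed X β → (∀ i → Le X (g i) β) →
                Le X (jj X (Sup X g)) β
    Qj-closed : ∀ {X Y} (f : Hom X Y) (α : Q₀ X) → Closed X α → Closed Y (Qj₁ f α)
    Qj-cong : ∀ {X Y} (f : Hom X Y) (α β : Q₀ X) → Closed X α → Closed X β →
              Eq X α β → Eq Y (Qj₁ f α) (Qj₁ f β)
    Qj-sup : ∀ {X Y} (f : Hom X Y) {J : Set ℓ} (g : J → Q₀ X) →
             (∀ i → Closed X (g i)) →
             Eq Y (Qj₁ f (jj X (Sup X g))) (jj Y (Sup Y (λ i → Qj₁ f (g i))))
    Qj-id : ∀ X (α : Q₀ X) → Closed X α → Eq X (Qj₁ (idC {X}) α) α
    Qj-∘  : ∀ {X Y Z} (f : Hom X Y) (g : Hom Y Z) (α : Q₀ X) → Closed X α →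
            Eq Z (Qj₁ (g ∘C f) α) (Qj₁ g (Qj₁ f α))
    jj-closed : ∀ X (α : Q₀ X) → Closed X (jj X α)
    jj-cong : ∀ X (α β : Q₀ X) → Eq X α β → Eq X (jj X α) (jj X β)
    jj-sup : ∀ X {J : Set ℓ} (g : J → Q₀ X) →
             Eq X (jj X (Sup X g)) (jj X (Sup X (λ i → jj X (g i))))
    jj-surjective : ∀ X (β : Q₀ X) → Closed X β → Σ (Q₀ X) (λ α → Eq X (jj X α) β)
    jj-natural : ∀ {X Y} (f : Hom X Y) (α : Q₀ X) →
                 Eq Y (Qj₁ f (jj X α)) (jj Y (Q₁ f α))
    iso-restricts : ∀ {X Y} (f : Hom X Y) → IsIso f →
                    ∀ (α : Q₀ X) → Closed X α → Closed Y (Q₁ f α)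

{-# OPTIONS --safe #-}
module Submission where

-- ȷ_X = (-)^⊥ ∘ ω_X is the closure operator of the antitone Galois connection
-- α ≤ β^⊥ ⇔ ⟨α , β⟩ ≤ ω ⇔ β ≤ ω_X(α) between Q(X) and Q(X*); everything about
-- Q^ȷ is then general closure-operator theory, except naturality.  For that,
-- the dual f* : Y* → X* of f : X → Y satisfies ⟨α , Q(f*) β⟩ = ⟨Q(f) α , β⟩,
-- which makes Q(f) ∘ ȷ_X ≤ ȷ_Y ∘ Q(f); for invertible f the same inequality
-- for f⁻¹ gives the reverse one on closed elements.

open import Level using (Lift; lift; _⊔_)
open import Data.Bool using (Bool; true; false)
open import Data.Product using (Σ; _,_; proj₁; proj₂)
open import Function.Bundles using (_⇔_; mk⇔; Equivalence)
open import Relation.Binary.Bundles using (Poset)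
open import Relation.Binary.PropositionalEquality as ≡ using (_≡_)
import Relation.Binary.Reasoning.PartialOrder as PosetReasoning
open import Defs

module CompleteLatticeProperties {ℓ} (L : CompleteLattice ℓ) where
  open CompleteLattice L

  poset : Poset ℓ ℓ ℓ
  poset = record { isPartialOrder = isPartialOrder }

  open Poset poset public using (refl; reflexive; trans; antisym; module Eq)

  binary : Carrier → Carrier → Lift ℓ Bool → Carrier
  binary x y (lift true)  = x
  binary x y (lift false) = y

  ⋁-binary-≤ : ∀ {x y} → x ≤ y → ⋁ (binary x y) ≈ y
  ⋁-binary-≤ {x} {y} x≤y =
    antisym (⋁-least (binary x y) y λ { (lift true) → x≤y ; (lift false) → refl })
            (⋁-upper (binary x y) (lift false))

module _ {ℓ} {A B : CompleteLattice ℓ} where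
  private
    module A = CompleteLattice A
    module B = CompleteLattice B
    module A′ = CompleteLatticeProperties A
    module B′ = CompleteLatticeProperties B
  open SupMap

  supMap-monotone : (h : SupMap A B) → ∀ {x y} → x A.≤ y → fun h x B.≤ fun h y
  supMap-monotone h {x} {y} x≤y = begin
    fun h x                              ≤⟨ B.⋁-upper (λ i → fun h (A′.binary x y i)) (lift true) ⟩
    B.⋁ (λ i → fun h (A′.binary x y i))  ≈⟨ pres-⋁ h (A′.binary x y) ⟨
    fun h (A.⋁ (A′.binary x y))          ≈⟨ cong h (A′.⋁-binary-≤ x≤y) ⟩
    fun h y                              ∎
    where open PosetReasoning B′.poset

  -- perp β and omegaX α are definitionally instances of this.
  rightAdjoint : SupMap A B → B.Carrier → A.Carrier
  rightAdjoint h c = A.⋁ {Σ A.Carrier (λ x → fun h x B.≤ c)} proj₁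

  ≤rightAdjoint⇔ : (h : SupMap A B) → ∀ {x c} → x A.≤ rightAdjoint h c ⇔ fun h x B.≤ c
  ≤rightAdjoint⇔ h {x} {c} = mk⇔ to (λ hx≤c → A.⋁-upper proj₁ (x , hx≤c))
    where
      open PosetReasoning B′.poset
      to : x A.≤ rightAdjoint h c → fun h x B.≤ c
      to x≤r = begin
        fun h x                      ≤⟨ supMap-monotone h x≤r ⟩
        fun h (rightAdjoint h c)     ≈⟨ pres-⋁ h proj₁ ⟩
        B.⋁ (λ i → fun h (proj₁ i))  ≤⟨ B.⋁-least _ c proj₂ ⟩
        c                            ∎

_∘ˢ_ : ∀ {ℓ} {A B C : CompleteLattice ℓ} → SupMap B C → SupMap A B → SupMap A C
_∘ˢ_ {C = C} g h = record
  { fun    = λ x → SupMap.fun g (SupMap.fun h x)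
  ; cong   = λ x≈y → SupMap.cong g (SupMap.cong h x≈y)
  ; pres-⋁ = λ xs → Eq.trans (SupMap.cong g (SupMap.pres-⋁ h xs)) (SupMap.pres-⋁ g _)
  }
  where open CompleteLatticeProperties C using (module Eq)

record IsClosureOperator {c ℓ₁ ℓ₂} (P : Poset c ℓ₁ ℓ₂) (j : Poset.Carrier P → Poset.Carrier P)
       : Set (c ⊔ ℓ₁ ⊔ ℓ₂) where
  open Poset P
  field
    extensive  : ∀ x → x ≤ j x
    monotone   : ∀ {x y} → x ≤ y → j x ≤ j y
    idempotent : ∀ x → j (j x) ≈ j x

module AntitoneGaloisConnection
  {a b ℓ₁ ℓ₂ ℓ₃ ℓ₄} (A : Poset a ℓ₁ ℓ₂) (B : Poset b ℓ₃ ℓ₄)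
  (f : Poset.Carrier A → Poset.Carrier B) (g : Poset.Carrier B → Poset.Carrier A)
  (galois : ∀ {x y} → Poset._≤_ A x (g y) ⇔ Poset._≤_ B y (f x))
  where
  private
    module A = Poset A
    module B = Poset B
  open Equivalence

  g∘f-extensive : ∀ x → x A.≤ g (f x)
  g∘f-extensive x = from galois B.refl

  f∘g-extensive : ∀ y → y B.≤ f (g y)
  f∘g-extensive y = to galois A.refl

  f-antitone : ∀ {x x′} → x A.≤ x′ → f x′ B.≤ f x
  f-antitone {x′ = x′} x≤x′ = to galois (A.trans x≤x′ (g∘f-extensive x′))

  g-antitone : ∀ {y y′} → y B.≤ y′ → g y′ A.≤ g y
  g-antitone {y′ = y′} y≤y′ = from galois (B.trans y≤y′ (f∘g-extensive y′))

  g∘f-isClosureOperator : IsClosureOperator A (λ x → g (f x))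
  g∘f-isClosureOperator = record
    { extensive  = g∘f-extensive
    ; monotone   = λ x≤x′ → g-antitone (f-antitone x≤x′)
    ; idempotent = λ x → A.antisym (g-antitone (f∘g-extensive (f x)))
                                   (g∘f-extensive (g (f x)))
    }

module ClosureOperatorProperties
  {ℓ} (L : CompleteLattice ℓ) {j : CompleteLattice.Carrier L → CompleteLattice.Carrier L}
  (isClosure : IsClosureOperator (CompleteLatticeProperties.poset L) j)
  where
  open CompleteLattice L
  open CompleteLatticeProperties L
  open IsClosureOperator isClosure
  open PosetReasoning poset

  j-cong : ∀ {x y} → x ≈ y → j x ≈ j y
  j-cong x≈y = antisym (monotone (reflexive x≈y)) (monotone (reflexive (Eq.sym x≈y)))

  ≤-j⋁ : ∀ {J : Set ℓ} (xs : J → Carrier) i → xs i ≤ j (⋁ xs)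
  ≤-j⋁ xs i = trans (⋁-upper xs i) (extensive (⋁ xs))

  j⋁-least : ∀ {J : Set ℓ} (xs : J → Carrier) y → j y ≈ y → (∀ i → xs i ≤ y) → j (⋁ xs) ≤ y
  j⋁-least xs y closed xs≤y = begin
    j (⋁ xs)  ≤⟨ monotone (⋁-least xs y xs≤y) ⟩
    j y       ≈⟨ closed ⟩
    y         ∎

  j⋁-j : ∀ {J : Set ℓ} (xs : J → Carrier) → j (⋁ xs) ≈ j (⋁ (λ i → j (xs i)))
  j⋁-j xs = antisym
    (monotone (⋁-least xs _ (λ i → trans (extensive (xs i)) (⋁-upper _ i))))
    (j⋁-least _ _ (idempotent (⋁ xs)) (λ i → monotone (⋁-upper xs i)))

module Main {o m ℓ} (S : Setting o m ℓ) where
  open Setting S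
  open Equivalence

  private
    module Lat X = CompleteLatticeProperties (F₀ X)
    module Reasoning X = PosetReasoning (Lat.poset X)
    O = dualizing

  Q₁-cong : ∀ {X Y} (f : Hom X Y) {x y} → Eq X x y → Eq Y (Q₁ f x) (Q₁ f y)
  Q₁-cong f = SupMap.cong (F₁ f)

  Q₁-monotone : ∀ {X Y} (f : Hom X Y) {x y} → Le X x y → Le Y (Q₁ f x) (Q₁ f y)
  Q₁-monotone f = supMap-monotone (F₁ f)

  Q₁-≡ : ∀ {X Y} {f g : Hom X Y} → f ≡ g → ∀ x → Eq Y (Q₁ f x) (Q₁ g x)
  Q₁-≡ {Y = Y} ≡.refl x = Lat.Eq.refl Y

  Q₁-inverse : ∀ {X Y} {f : Hom X Y} {g : Hom Y X} → g ∘ f ≡ id → ∀ x → Eq X (Q₁ g (Q₁ f x)) x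
  Q₁-inverse {X} {f = f} {g} g∘f≡id x =
    Lat.Eq.trans X (Lat.Eq.sym X (F-∘ f g x)) (Lat.Eq.trans X (Q₁-≡ g∘f≡id x) (F-id x))

  μ⟨-,_⟩ : ∀ {X Y} → Q₀ Y → SupMap (F₀ X) (F₀ (X ⊗₀ Y))
  μ⟨-, y ⟩ = record
    { fun = λ x → μ x y ; cong = λ x≈x′ → μ-cong x≈x′ (Lat.Eq.refl _) ; pres-⋁ = λ xs → μ-⋁ˡ xs y }

  μ⟨_,-⟩ : ∀ {X Y} → Q₀ X → SupMap (F₀ Y) (F₀ (X ⊗₀ Y))
  μ⟨ x ,-⟩ = record
    { fun = λ y → μ x y ; cong = λ y≈y′ → μ-cong (Lat.Eq.refl _) y≈y′ ; pres-⋁ = λ ys → μ-⋁ʳ x ys }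

  ≤perp⇔ : ∀ {X} {α : Q₀ X} {β} → Le X α (perp β) ⇔ Le O (pair α β) ω
  ≤perp⇔ {β = β} = ≤rightAdjoint⇔ (F₁ ev ∘ˢ μ⟨-, β ⟩)

  ≤omegaX⇔ : ∀ {X} {α : Q₀ X} {β} → Le (X ⊸ O) β (omegaX α) ⇔ Le O (pair α β) ω
  ≤omegaX⇔ {α = α} = ≤rightAdjoint⇔ (F₁ ev ∘ˢ μ⟨ α ,-⟩)

  module PerpGalois X = AntitoneGaloisConnection (Lat.poset X) (Lat.poset (X ⊸ O))
    omegaX perp (mk⇔ (λ α≤β⊥ → from ≤omegaX⇔ (to ≤perp⇔ α≤β⊥))
                     (λ β≤ωα → from ≤perp⇔ (to ≤omegaX⇔ β≤ωα)))

  jj-isClosureOperator : ∀ X → IsClosureOperator (Lat.poset X) (jj X)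
  jj-isClosureOperator X = PerpGalois.g∘f-isClosureOperator X

  module JJ X = ClosureOperatorProperties (F₀ X) (jj-isClosureOperator X)
  open IsClosureOperator using (extensive; monotone; idempotent)

  dual : ∀ {X Y} → Hom X Y → Hom (Y ⊸ O) (X ⊸ O)
  dual f = curry (ev ∘ (f ⊗₁ id))

  pair-dual : ∀ {X Y} (f : Hom X Y) (α : Q₀ X) (β : Q₀ (Y ⊸ O)) →
              Eq O (pair α (Q₁ (dual f) β)) (pair (Q₁ f α) β)
  pair-dual {X} {Y} f α β = begin-equality
    Q₁ ev (μ α (Q₁ (dual f) β))                ≈⟨ Q₁-cong ev (μ-cong (F-id α) (Lat.Eq.refl _)) ⟨
    Q₁ ev (μ (Q₁ id α) (Q₁ (dual f) β))        ≈⟨ Q₁-cong ev (μ-natural id (dual f) α β) ⟨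
    Q₁ ev (Q₁ (id ⊗₁ dual f) (μ α β))          ≈⟨ F-∘ (id ⊗₁ dual f) ev (μ α β) ⟨
    Q₁ (ev ∘ (id ⊗₁ dual f)) (μ α β)           ≈⟨ Q₁-≡ ev-curry (μ α β) ⟩
    Q₁ (ev ∘ (f ⊗₁ id)) (μ α β)                ≈⟨ F-∘ (f ⊗₁ id) ev (μ α β) ⟩
    Q₁ ev (Q₁ (f ⊗₁ id) (μ α β))               ≈⟨ Q₁-cong ev (μ-natural f id α β) ⟩
    Q₁ ev (μ (Q₁ f α) (Q₁ id β))               ≈⟨ Q₁-cong ev (μ-cong (Lat.Eq.refl Y) (F-id β)) ⟩
    Q₁ ev (μ (Q₁ f α) β)                       ∎
    where open Reasoning O

  Q₁-perp-dual : ∀ {X Y} (f : Hom X Y) (β : Q₀ (Y ⊸ O)) →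
                 Le Y (Q₁ f (perp (Q₁ (dual f) β))) (perp β)
  Q₁-perp-dual f β = from ≤perp⇔ (begin
    pair (Q₁ f (perp (Q₁ (dual f) β))) β        ≈⟨ pair-dual f _ β ⟨
    pair (perp (Q₁ (dual f) β)) (Q₁ (dual f) β) ≤⟨ to ≤perp⇔ (Lat.refl _) ⟩
    ω                                           ∎)
    where open Reasoning O

  Q₁-dual-omegaX : ∀ {X Y} (f : Hom X Y) (α : Q₀ X) →
                   Le (X ⊸ O) (Q₁ (dual f) (omegaX (Q₁ f α))) (omegaX α)
  Q₁-dual-omegaX f α = from ≤omegaX⇔ (begin
    pair α (Q₁ (dual f) (omegaX (Q₁ f α)))      ≈⟨ pair-dual f α _ ⟩
    pair (Q₁ f α) (omegaX (Q₁ f α))             ≤⟨ to ≤omegaX⇔ (Lat.refl _) ⟩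
    ω                                           ∎)
    where open Reasoning O

  Q₁-jj-≤ : ∀ {X Y} (f : Hom X Y) (α : Q₀ X) → Le Y (Q₁ f (jj X α)) (jj Y (Q₁ f α))
  Q₁-jj-≤ {X} {Y} f α = begin
    Q₁ f (perp (omegaX α))
      ≤⟨ Q₁-monotone f (PerpGalois.g-antitone X (Q₁-dual-omegaX f α)) ⟩
    Q₁ f (perp (Q₁ (dual f) (omegaX (Q₁ f α))))
      ≤⟨ Q₁-perp-dual f _ ⟩
    perp (omegaX (Q₁ f α))
      ∎
    where open Reasoning Y

  jj-natural : ∀ {X Y} (f : Hom X Y) (α : Q₀ X) → Eq Y (jj Y (Q₁ f (jj X α))) (jj Y (Q₁ f α))
  jj-natural {X} {Y} f α = Lat.antisym Y
    (Lat.trans Y (monotone (jj-isClosureOperator Y) (Q₁-jj-≤ f α))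
                 (Lat.reflexive Y (idempotent (jj-isClosureOperator Y) _)))
    (monotone (jj-isClosureOperator Y) (Q₁-monotone f (extensive (jj-isClosureOperator X) α)))

  iso-preserves-Closed : ∀ {X Y} (f : Hom X Y) → IsIso f → ∀ α → Closed X α → Closed Y (Q₁ f α)
  iso-preserves-Closed {X} {Y} f iso α closed =
    Lat.antisym Y jjfα≤fα (extensive (jj-isClosureOperator Y) (Q₁ f α))
    where
      open IsIso iso
      open Reasoning Y
      jjfα≤fα : Le Y (jj Y (Q₁ f α)) (Q₁ f α)
      jjfα≤fα = begin
        jj Y (Q₁ f α)                       ≈⟨ Q₁-inverse isoʳ _ ⟨
        Q₁ f (Q₁ inv (jj Y (Q₁ f α)))       ≤⟨ Q₁-monotone f (Q₁-jj-≤ inv (Q₁ f α)) ⟩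
        Q₁ f (jj X (Q₁ inv (Q₁ f α)))       ≈⟨ Q₁-cong f (JJ.j-cong X (Q₁-inverse isoˡ α)) ⟩
        Q₁ f (jj X α)                       ≈⟨ Q₁-cong f closed ⟩
        Q₁ f α                              ∎

  conclusion : Conclusion S
  conclusion = record
    { jj-extensive  = λ X → extensive (jj-isClosureOperator X)
    ; jj-monotone   = λ X _ _ → monotone (jj-isClosureOperator X)
    ; jj-idempotent = λ X → idempotent (jj-isClosureOperator X)
    ; sup-closed    = λ X xs _ → idempotent (jj-isClosureOperator X) (Sup X xs)
    ; sup-upper     = λ X xs _ → JJ.≤-j⋁ X xs
    ; sup-least     = λ X xs _ → JJ.j⋁-least X xs
    ; Qj-closed     = λ {_} {Y} f α _ → idempotent (jj-isClosureOperator Y) (Q₁ f α)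
    ; Qj-cong       = λ {_} {Y} f _ _ _ _ α≈β → JJ.j-cong Y (Q₁-cong f α≈β)
    ; Qj-sup        = λ {X} {Y} f xs _ → Lat.Eq.trans Y (jj-natural f (Sup X xs))
                        (Lat.Eq.trans Y (JJ.j-cong Y (SupMap.pres-⋁ (F₁ f) xs)) (JJ.j⋁-j Y _))
    ; Qj-id         = λ X α closed → Lat.Eq.trans X (JJ.j-cong X (F-id α)) closed
    ; Qj-∘          = λ {Z = Z} f g α _ → Lat.Eq.trans Z (JJ.j-cong Z (F-∘ f g α))
                                                        (Lat.Eq.sym Z (jj-natural g (Q₁ f α)))
    ; jj-closed     = λ X → idempotent (jj-isClosureOperator X)
    ; jj-cong       = λ X _ _ → JJ.j-cong X
    ; jj-sup        = λ X → JJ.j⋁-j X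
    ; jj-surjective = λ _ β closed → β , closed
    ; jj-natural    = jj-natural
    ; iso-restricts = iso-preserves-Closed
    }

mainTheorem11 : ∀ {o m ℓ} (S : Setting o m ℓ) → Conclusion S
mainTheorem11 = Main.conclusion
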